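{- On the class of cycles, the AMP (Avoid Midpoint) algorithm with two agents has competitive ratio $1$ in the energy model and competitive ratio $1.5$ in the time model.
   Context: Multi-agent online graph exploration: an undirected connected graph $G=(V,E)$ with positive edge lengths $l(e)$ and distinctly labelled nodes is initially unknown. Agents start at a node $s$; initially they know $s$, its incident edges (with lengths) and its neighbours. Whenever an agent visits a node $v$ for the first time, all edges incident to $v$ (with lengths) and the neighbours of $v$ are revealed. Agents share all information instantly, have unlimited computation, move at unit speed (traversing $e$ takes time $l(e)$), and may wait. The exploration is finished when every node has been visited and all agents are back at $s$. Time model: cost is the finishing time. Energy model: cost is the maximum total distance travelled by any single agent. $opt(G,s,k)$ is the minimum cost of an exploration by $k$ agents with full prior knowledge of $G$; an online algorithm has competitive ratio $c$ on a class if $c$ is the supremum of its cost divided by $opt(G,s,k)$ over all $G$ in the class and $s\in V$. A cycle is a connected graph in which every node has degree 2. AMP algorithm: two agents $a_1,a_2$ start at $s$ with travelled distances $d(a_1)=d(a_2)=0$; the two neighbours of $s$ are assigned (randomly) as the next nodes $n(a_1),n(a_2)$, so the agents go around the cycle in opposite directions; let $l_i$ be the length of the edge from the current position of $a_i$ to $n(a_i)$. While not all nodes have been visited: if $d(a_1)+l_1<d(a_2)+l_2$ then $a_1$ traverses its edge to $n(a_1)$, otherwise $a_2$ traverses its edge to $n(a_2)$; the moving agent adds the edge length to its travelled distance and its next node becomes the newly revealed neighbour (only one agent moves at a time). Afterwards both agents return to $s$ along shortest paths.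
   Formalization: The edge lengths of the cycles are positive rationals rather than positive reals, and the waiting times of the offline explorations defining opt are likewise rational. -}

module Defs where

open import Data.Nat as ℕ using (ℕ; zero; suc; _∸_)
open import Data.Bool using (Bool; true; false; if_then_else_)
open import Data.List using (List; []; _∷_; length; take; drop; foldr; upTo)
open import Data.List.Relation.Unary.All using (All)
open import Data.List.Membership.DecPropositional ℕ._≟_ using (_∈?_)
open import Data.Rational using (ℚ; 0ℚ; 1ℚ; _+_; _-_; _*_; _<_; _≤_; _⊔_; _⊓_; Positive; NonNegative; _/_)
open import Data.Integer using (+_)
open import Data.Rational.Properties using (_<?_)
open import Relation.Nullary.Decidable using (does)
open import Relation.Binary.PropositionalEquality using (_≡_)
open import Data.Product using (_×_)
open import Data.Sum using (_⊎_)

-- Weighted cycles.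
-- A cycle with n = length lens ≥ 3 nodes 0,…,n-1 (node 0 is the start s).
-- Edge i (i < n) joins node i and node (i+1 mod n) and has length lens[i] > 0.

record Cycle : Set where
  field
    lens   : List ℚ
    three≤ : 3 ℕ.≤ length lens
    pos    : All Positive lens
open Cycle public

size : Cycle → ℕ
size C = length (lens C)

sumℚ : List ℚ → ℚ
sumℚ = foldr _+_ 0ℚ

-- list lookup with a default (only ever used with indices < size)
nth : List ℚ → ℕ → ℚ
nth []       _       = 0ℚ
nth (x ∷ _)  zero    = x
nth (_ ∷ xs) (suc i) = nth xs i

data Dir : Set where
  cw ccw : Dir

opp : Dir → Dir
opp cw  = ccw
opp ccw = cw

step : Cycle → Dir → ℕ → ℕ
step C cw  p = if does (suc p ℕ.≟ size C) then 0 else suc p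
step C ccw zero    = size C ∸ 1
step C ccw (suc q) = q

stepLen : Cycle → Dir → ℕ → ℚ
stepLen C cw  p = nth (lens C) p
stepLen C ccw p = nth (lens C) (step C ccw p)

data Action : Set where
  move : Dir → Action
  wait : ℚ → Action

Schedule : Set
Schedule = List Action

endPos : Cycle → ℕ → Schedule → ℕ
endPos C p []              = p
endPos C p (move d ∷ as)   = endPos C (step C d p) as
endPos C p (wait _ ∷ as)   = endPos C p as

distance : Cycle → ℕ → Schedule → ℚ
distance C p []            = 0ℚ
distance C p (move d ∷ as) = stepLen C d p + distance C (step C d p) as
distance C p (wait _ ∷ as) = distance C p as

duration : Cycle → ℕ → Schedule → ℚ
duration C p []            = 0ℚ
duration C p (move d ∷ as) = stepLen C d p + duration C (step C d p) as
duration C p (wait t ∷ as) = t + duration C p as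

waitsOK : Schedule → Set
waitsOK []            = Data.Unit.⊤ where import Data.Unit
waitsOK (move _ ∷ as) = waitsOK as
waitsOK (wait t ∷ as) = NonNegative t × waitsOK as

Visits : Cycle → ℕ → Schedule → ℕ → Set
Visits C p []            v = v ≡ p
Visits C p (move d ∷ as) v = v ≡ p ⊎ Visits C (step C d p) as v
Visits C p (wait _ ∷ as) v = v ≡ p ⊎ Visits C p as v

Exploration : Cycle → Schedule → Schedule → Set
Exploration C w₁ w₂ =
  waitsOK w₁ × waitsOK w₂ ×
  endPos C 0 w₁ ≡ 0 × endPos C 0 w₂ ≡ 0 ×
  (∀ v → v ℕ.< size C → Visits C 0 w₁ v ⊎ Visits C 0 w₂ v)

energyCost : Cycle → Schedule → Schedule → ℚ
energyCost C w₁ w₂ = distance C 0 w₁ ⊔ distance C 0 w₂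

timeCost : Cycle → Schedule → Schedule → ℚ
timeCost C w₁ w₂ = duration C 0 w₁ ⊔ duration C 0 w₂

-- The AMP algorithm.  The Bool b encodes the (random) assignment of the
-- two neighbours of s: b = true means a₁ goes clockwise (towards node 1).

dir₁ : Bool → Dir
dir₁ true  = cw
dir₁ false = ccw

record AMPState : Set where
  constructor st
  field
    p₁ p₂   : ℕ
    d₁ d₂   : ℚ
    visited : List ℕ
open AMPState public

allB : (ℕ → Bool) → List ℕ → Bool
allB f []       = true
allB f (x ∷ xs) = if f x then allB f xs else false

allVisited : Cycle → List ℕ → Bool
allVisited C vis = allB (λ v → does (v ∈? vis)) (upTo (size C))

ampStep : Cycle → Bool → AMPState → AMPState
ampStep C b (st p₁ p₂ d₁ d₂ vis) =
  if does ((d₁ + stepLen C (dir₁ b) p₁) <? (d₂ + stepLen C (opp (dir₁ b)) p₂))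
  then st (step C (dir₁ b) p₁) p₂ (d₁ + stepLen C (dir₁ b) p₁) d₂
          (step C (dir₁ b) p₁ ∷ vis)
  else st p₁ (step C (opp (dir₁ b)) p₂) d₁ (d₂ + stepLen C (opp (dir₁ b)) p₂)
          (step C (opp (dir₁ b)) p₂ ∷ vis)

-- "while not all nodes visited" with fuel (size C iterations suffice,
-- since every iteration visits a new node)
ampLoop : Cycle → Bool → ℕ → AMPState → AMPState
ampLoop C b zero    s = s
ampLoop C b (suc f) s =
  if allVisited C (visited s) then s else ampLoop C b f (ampStep C b s)

ampRun : Cycle → Bool → AMPState
ampRun C b = ampLoop C b (size C) (st 0 0 0ℚ 0ℚ (0 ∷ []))

-- shortest-path distance from node p back to s = 0: the shorter of the
-- two arcs (edges 0..p-1, resp. edges p..n-1)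
returnDist : Cycle → ℕ → ℚ
returnDist C p = sumℚ (take p (lens C)) ⊓ sumℚ (drop p (lens C))

ampEnergy : Cycle → Bool → ℚ
ampEnergy C b =
  (d₁ (ampRun C b) + returnDist C (p₁ (ampRun C b))) ⊔
  (d₂ (ampRun C b) + returnDist C (p₂ (ampRun C b)))

-- time model: only one agent moves at a time during exploration, then both
-- return to s simultaneously
ampTime : Cycle → Bool → ℚ
ampTime C b =
  d₁ (ampRun C b) + d₂ (ampRun C b) +
  (returnDist C (p₁ (ampRun C b)) ⊔ returnDist C (p₂ (ampRun C b)))

three/two : ℚ
three/two = + 3 / 2

{-# OPTIONS --safe #-}
module Submission where

-- Let ρ(v) be the length of a shortest path from v back to s. Along an edge e, ρ changes
-- by at most l(e), so every closed walk from s through v has length at least 2ρ(v), and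
-- every offline exploration costs at least 2ρ(v) for every node v, in both models.
-- AMP keeps each agent's travelled distance equal to the arc from s to its position, and
-- that arc no longer than the opposite arc from s: an agent only advances if its new arc
-- is at most the other agent's next arc, which is part of the opposite arc. Hence an agent
-- at p has travelled d ≤ ρ(p). In the energy model it thus pays d + ρ(p) ≤ 2ρ(p) ≤ opt;
-- in the time model AMP needs d₁ + d₂ + max ρ(pᵢ) ≤ 3 max ρ(pᵢ) ≤ (3/2) opt. On the
-- triangle with unit edges AMP pays 2 and 3 against an offline cost of 2 in both models.

open import Defs
open import Data.Bool using (Bool; true; false; if_then_else_)
open import Data.Empty using (⊥-elim)
open import Data.Nat as ℕ using (ℕ; zero; suc; pred; z≤n; s≤s)
open import Data.List using (List; []; _∷_; length; take; drop; upTo)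
open import Data.List.Membership.DecPropositional ℕ._≟_ using (_∈_; _∈?_)
open import Data.List.Membership.Propositional.Properties using (∈-upTo⁻)
open import Data.List.Properties using (drop-all)
open import Data.List.Relation.Unary.All as All using (All; []; _∷_)
open import Data.List.Relation.Unary.All.Properties using (take⁺)
open import Data.List.Relation.Unary.Any using (here; there)
import Data.Nat.Properties as ℕₚ
open import Data.Product using (_×_; Σ-syntax; _,_; proj₁; proj₂; swap)
open import Data.Rational using (ℚ; 0ℚ; 1ℚ; _+_; _-_; _*_; _<_; _≤_; _⊔_; _⊓_; Positive)
open import Data.Rational.Properties
open import Data.Rational.Solver using (module +-*-Solver)
open import Data.Sum using (_⊎_; inj₁; inj₂)
open import Function using (_∘_)
open import Relation.Nullary using (Dec; yes; no; ¬_; does)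
open import Relation.Nullary.Decidable using (dec-true; dec-false)
open import Relation.Binary.PropositionalEquality
  using (_≡_; refl; sym; trans; cong; subst; subst₂; module ≡-Reasoning)

p≤q+p : ∀ {p q} → 0ℚ ≤ q → p ≤ q + p
p≤q+p {p} {q} 0≤q = subst (_≤ q + p) (+-identityˡ p) (+-monoˡ-≤ p 0≤q)

p≤p+q : ∀ {p q} → 0ℚ ≤ q → p ≤ p + q
p≤p+q {p} {q} 0≤q = subst (_≤ p + q) (+-identityʳ p) (+-monoʳ-≤ p 0≤q)

p-q<p : ∀ p {q} → Positive q → p - q < p
p-q<p p {q} q>0 =
  subst (p - q <_) (+-identityʳ p) (+-monoʳ-< p (neg-antimono-< (positive⁻¹ q {{q>0}})))

[p⊔q]+[p⊔q]≡[p+p]⊔[q+q] : ∀ p q → (p ⊔ q) + (p ⊔ q) ≡ (p + p) ⊔ (q + q)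
[p⊔q]+[p⊔q]≡[p+p]⊔[q+q] = mono-≤-distrib-⊔ (λ p≤q → +-mono-≤ p≤q p≤q)

DifferByAtMost : ℚ → ℚ → ℚ → Set
DifferByAtMost l p q = p ≤ l + q × q ≤ l + p

differ-+ : ∀ {l p} → 0ℚ ≤ l → DifferByAtMost l (p + l) p
differ-+ {l} {p} 0≤l = ≤-reflexive (+-comm p l) , ≤-trans (p≤p+q 0≤l) (p≤q+p 0≤l)

differ-⊓ : ∀ {l p q p′ q′} → DifferByAtMost l p q → DifferByAtMost l p′ q′ →
           DifferByAtMost l (p ⊓ p′) (q ⊓ q′)
differ-⊓ {l} {p} {q} {p′} {q′} (p≤ , q≤) (p′≤ , q′≤) =
    ≤-trans (⊓-mono-≤ p≤ p′≤) (≤-reflexive (sym (l+-distrib-⊓ q q′)))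
  , ≤-trans (⊓-mono-≤ q≤ q′≤) (≤-reflexive (sym (l+-distrib-⊓ p p′)))
  where
  l+-distrib-⊓ : ∀ a b → l + (a ⊓ b) ≡ (l + a) ⊓ (l + b)
  l+-distrib-⊓ = mono-≤-distrib-⊓ (+-monoʳ-≤ l)

NonNegatives : List ℚ → Set
NonNegatives = All (0ℚ ≤_)

sumℚ-nonNeg : ∀ {xs} → NonNegatives xs → 0ℚ ≤ sumℚ xs
sumℚ-nonNeg []           = ≤-refl
sumℚ-nonNeg (0≤x ∷ 0≤xs) = ≤-trans (sumℚ-nonNeg 0≤xs) (p≤q+p 0≤x)

nth-nonNeg : ∀ {xs} → NonNegatives xs → ∀ i → 0ℚ ≤ nth xs i
nth-nonNeg []         _       = ≤-refl
nth-nonNeg (0≤x ∷ _)  zero    = 0≤x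
nth-nonNeg (_ ∷ 0≤xs) (suc i) = nth-nonNeg 0≤xs i

sumℚ-take-mono : ∀ {xs m m′} → NonNegatives xs → m ℕ.≤ m′ →
                 sumℚ (take m xs) ≤ sumℚ (take m′ xs)
sumℚ-take-mono {m′ = m′} 0≤xs       z≤n        = sumℚ-nonNeg (take⁺ m′ 0≤xs)
sumℚ-take-mono           []         (s≤s _)    = ≤-refl
sumℚ-take-mono {x ∷ _}   (_ ∷ 0≤xs) (s≤s m≤m′) = +-monoʳ-≤ x (sumℚ-take-mono 0≤xs m≤m′)

sumℚ-drop≤sumℚ : ∀ {xs} → NonNegatives xs → ∀ m → sumℚ (drop m xs) ≤ sumℚ xs
sumℚ-drop≤sumℚ _            zero    = ≤-refl
sumℚ-drop≤sumℚ []           (suc m) = ≤-refl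
sumℚ-drop≤sumℚ (0≤x ∷ 0≤xs) (suc m) = ≤-trans (sumℚ-drop≤sumℚ 0≤xs m) (p≤q+p 0≤x)

sumℚ-drop-antimono : ∀ {xs m m′} → NonNegatives xs → m ℕ.≤ m′ →
                     sumℚ (drop m′ xs) ≤ sumℚ (drop m xs)
sumℚ-drop-antimono {m′ = m′} 0≤xs       z≤n        = sumℚ-drop≤sumℚ 0≤xs m′
sumℚ-drop-antimono           []         (s≤s _)    = ≤-refl
sumℚ-drop-antimono           (_ ∷ 0≤xs) (s≤s m≤m′) = sumℚ-drop-antimono 0≤xs m≤m′

sumℚ-take-suc : ∀ xs {i} → i ℕ.< length xs → sumℚ (take (suc i) xs) ≡ sumℚ (take i xs) + nth xs i
sumℚ-take-suc (x ∷ xs) {zero}  _           = trans (+-identityʳ x) (sym (+-identityˡ x))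
sumℚ-take-suc (x ∷ xs) {suc i} (s≤s i<len) =
  trans (cong (x +_) (sumℚ-take-suc xs i<len)) (sym (+-assoc x _ _))

sumℚ-drop-suc : ∀ xs {i} → i ℕ.< length xs → sumℚ (drop i xs) ≡ sumℚ (drop (suc i) xs) + nth xs i
sumℚ-drop-suc (x ∷ xs) {zero}  _           = +-comm x _
sumℚ-drop-suc (x ∷ xs) {suc i} (s≤s i<len) = sumℚ-drop-suc xs i<len

if-does-elim : ∀ {A Q : Set} (P : A → Set) (q? : Dec Q) {x y : A} →
               (Q → P x) → (¬ Q → P y) → P (if does q? then x else y)
if-does-elim P (yes q) onYes _    = onYes q
if-does-elim P (no ¬q) _    onNo = onNo ¬q

allB-complete : ∀ {f} xs → (∀ {x} → x ∈ xs → f x ≡ true) → allB f xs ≡ true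
allB-complete []       _ = refl
allB-complete (x ∷ xs) all rewrite all (here refl) = allB-complete xs (all ∘ there)

module _ (C : Cycle) where

  private
    n : ℕ
    n = size C

  0<size : 0 ℕ.< n
  0<size = ℕₚ.<-≤-trans (s≤s z≤n) (three≤ C)

  suc-pred-size : suc (pred n) ≡ n
  suc-pred-size = ℕₚ.suc-pred n {{ℕ.>-nonZero 0<size}}

  step-cw-inner : ∀ {p} → suc p ℕ.< n → step C cw p ≡ suc p
  step-cw-inner {p} sp<n rewrite dec-false (suc p ℕ.≟ n) (ℕₚ.<⇒≢ sp<n) = refl

  step-cw-last : ∀ {p} → suc p ≡ n → step C cw p ≡ 0
  step-cw-last {p} sp≡n rewrite dec-true (suc p ℕ.≟ n) sp≡n = refl

  step<size : ∀ d {p} → p ℕ.< n → step C d p ℕ.< n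
  step<size cw {p} p<n with ℕₚ.m≤n⇒m<n∨m≡n p<n
  ... | inj₁ sp<n = subst (ℕ._< n) (sym (step-cw-inner sp<n)) sp<n
  ... | inj₂ sp≡n = subst (ℕ._< n) (sym (step-cw-last sp≡n)) 0<size
  step<size ccw {zero}  _   = subst (pred n ℕ.<_) suc-pred-size (ℕₚ.n<1+n (pred n))
  step<size ccw {suc p} p<n = ℕₚ.<-trans (ℕₚ.n<1+n p) p<n

  step-ccw-cw : ∀ {p} → p ℕ.< n → step C ccw (step C cw p) ≡ p
  step-ccw-cw {p} p<n with ℕₚ.m≤n⇒m<n∨m≡n p<n
  ... | inj₁ sp<n rewrite step-cw-inner sp<n = refl
  ... | inj₂ sp≡n rewrite step-cw-last sp≡n = ℕₚ.suc-injective (trans suc-pred-size (sym sp≡n))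

  step-cw-ccw : ∀ {p} → p ℕ.< n → step C cw (step C ccw p) ≡ p
  step-cw-ccw {zero}  _   = step-cw-last suc-pred-size
  step-cw-ccw {suc p} p<n = step-cw-inner p<n

  cwArc ccwArc : ℕ → ℚ
  cwArc  m = sumℚ (take m (lens C))
  ccwArc m = sumℚ (drop m (lens C))

  lens-nonNeg : NonNegatives (lens C)
  lens-nonNeg = All.map (λ {x} x>0 → <⇒≤ (positive⁻¹ x {{x>0}})) (pos C)

  cwArc-nonNeg : ∀ m → 0ℚ ≤ cwArc m
  cwArc-nonNeg m = sumℚ-nonNeg (take⁺ m lens-nonNeg)

  cwArc-suc : ∀ {p} → p ℕ.< n → cwArc (suc p) ≡ cwArc p + stepLen C cw p
  cwArc-suc = sumℚ-take-suc (lens C)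

  ccwArc-suc : ∀ {p} → p ℕ.< n → ccwArc p ≡ ccwArc (suc p) + stepLen C cw p
  ccwArc-suc = sumℚ-drop-suc (lens C)

  ccwArc-size : ccwArc n ≡ 0ℚ
  ccwArc-size = cong sumℚ (drop-all n (lens C) ℕₚ.≤-refl)

  private
    ρ : ℕ → ℚ
    ρ = returnDist C

  returnDist-0 : ρ 0 ≡ 0ℚ
  returnDist-0 = p≤q⇒p⊓q≡p (sumℚ-nonNeg lens-nonNeg)

  returnDist-size : ρ n ≡ 0ℚ
  returnDist-size = trans (cong (cwArc n ⊓_) ccwArc-size) (p≥q⇒p⊓q≡q (cwArc-nonNeg n))

  returnDist-suc : ∀ {p} → p ℕ.< n → DifferByAtMost (stepLen C cw p) (ρ (suc p)) (ρ p)
  returnDist-suc {p} p<n = differ-⊓ {stepLen C cw p} cw-part ccw-part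
    where
    l≥0 : 0ℚ ≤ stepLen C cw p
    l≥0 = nth-nonNeg lens-nonNeg p
    cw-part : DifferByAtMost (stepLen C cw p) (cwArc (suc p)) (cwArc p)
    cw-part rewrite cwArc-suc p<n = differ-+ l≥0
    ccw-part : DifferByAtMost (stepLen C cw p) (ccwArc (suc p)) (ccwArc p)
    ccw-part rewrite ccwArc-suc p<n = swap (differ-+ l≥0)

  returnDist-step-cw : ∀ {p} → p ℕ.< n → ρ (step C cw p) ≡ ρ (suc p)
  returnDist-step-cw {p} p<n with ℕₚ.m≤n⇒m<n∨m≡n p<n
  ... | inj₁ sp<n = cong ρ (step-cw-inner sp<n)
  ... | inj₂ sp≡n = begin
    ρ (step C cw p) ≡⟨ cong ρ (step-cw-last sp≡n) ⟩
    ρ 0             ≡⟨ trans returnDist-0 (sym returnDist-size) ⟩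
    ρ n             ≡⟨ cong ρ (sym sp≡n) ⟩
    ρ (suc p)       ∎
    where open ≡-Reasoning

  returnDist-step : ∀ d {p} → p ℕ.< n → DifferByAtMost (stepLen C d p) (ρ (step C d p)) (ρ p)
  returnDist-step cw {p} p<n =
    subst (λ a → DifferByAtMost (stepLen C cw p) a (ρ p)) (sym (returnDist-step-cw p<n)) (returnDist-suc p<n)
  returnDist-step ccw {p} p<n =
    subst (λ a → DifferByAtMost (stepLen C ccw p) (ρ (step C ccw p)) (ρ a)) (step-cw-ccw p<n)
          (swap (returnDist-step cw (step<size ccw p<n)))

  returnDist-walk : ∀ {p} w → p ℕ.< n → ρ p ≤ distance C p w + ρ (endPos C p w)
  returnDist-walk []           _   = ≤-reflexive (sym (+-identityˡ _))
  returnDist-walk {p} (move d ∷ w) p<n = begin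
    ρ p                          ≤⟨ proj₂ (returnDist-step d p<n) ⟩
    l + ρ q                      ≤⟨ +-monoʳ-≤ l (returnDist-walk w (step<size d p<n)) ⟩
    l + (distance C q w + ρ e)   ≡⟨ sym (+-assoc l (distance C q w) (ρ e)) ⟩
    (l + distance C q w) + ρ e   ∎
    where
    open ≤-Reasoning
    q e : ℕ
    q = step C d p
    e = endPos C q w
    l : ℚ
    l = stepLen C d p
  returnDist-walk (wait _ ∷ w) p<n = returnDist-walk w p<n

  returnDist-visit : ∀ {p v} w → p ℕ.< n → Visits C p w v →
                     ρ v + ρ v ≤ ρ p + (distance C p w + ρ (endPos C p w))
  returnDist-visit {p} []           p<n refl        = +-monoʳ-≤ (ρ p) (returnDist-walk [] p<n)
  returnDist-visit {p} (move d ∷ w) p<n (inj₁ refl) = +-monoʳ-≤ (ρ p) (returnDist-walk (move d ∷ w) p<n)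
  returnDist-visit {p} (wait t ∷ w) p<n (inj₁ refl) = +-monoʳ-≤ (ρ p) (returnDist-walk (wait t ∷ w) p<n)
  returnDist-visit (wait _ ∷ w) p<n (inj₂ visits) = returnDist-visit w p<n visits
  returnDist-visit {p} {v} (move d ∷ w) p<n (inj₂ visits) = begin
    ρ v + ρ v                           ≤⟨ returnDist-visit w (step<size d p<n) visits ⟩
    ρ q + (distance C q w + ρ e)        ≤⟨ +-monoˡ-≤ _ (proj₁ (returnDist-step d p<n)) ⟩
    (l + ρ p) + (distance C q w + ρ e)  ≡⟨ regroup l (ρ p) (distance C q w) (ρ e) ⟩
    ρ p + ((l + distance C q w) + ρ e)  ∎
    where
    open ≤-Reasoning
    open +-*-Solver
    q e : ℕ
    q = step C d p
    e = endPos C q w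
    l : ℚ
    l = stepLen C d p
    regroup : ∀ a b c x → (a + b) + (c + x) ≡ b + ((a + c) + x)
    regroup = solve 4 (λ a b c x → (a :+ b) :+ (c :+ x) := b :+ ((a :+ c) :+ x)) refl

  closedWalk-visit : ∀ {v} w → endPos C 0 w ≡ 0 → Visits C 0 w v → ρ v + ρ v ≤ distance C 0 w
  closedWalk-visit {v} w closed visits = begin
    ρ v + ρ v                                   ≤⟨ returnDist-visit w 0<size visits ⟩
    ρ 0 + (distance C 0 w + ρ (endPos C 0 w))   ≡⟨ cong (λ e → ρ 0 + (distance C 0 w + ρ e)) closed ⟩
    ρ 0 + (distance C 0 w + ρ 0)                ≡⟨ cong (λ z → z + (distance C 0 w + z)) returnDist-0 ⟩
    0ℚ + (distance C 0 w + 0ℚ)                  ≡⟨ trans (+-identityˡ _) (+-identityʳ _) ⟩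
    distance C 0 w                              ∎
    where open ≤-Reasoning

  energyCost-lowerBound : ∀ {w₁ w₂ v} → Exploration C w₁ w₂ → v ℕ.< n →
                          ρ v + ρ v ≤ energyCost C w₁ w₂
  energyCost-lowerBound {w₁} {w₂} {v} (_ , _ , closed₁ , closed₂ , covers) v<n with covers v v<n
  ... | inj₁ visits = ≤-trans (closedWalk-visit w₁ closed₁ visits) (p≤p⊔q (distance C 0 w₁) _)
  ... | inj₂ visits = ≤-trans (closedWalk-visit w₂ closed₂ visits) (p≤q⊔p (distance C 0 w₁) _)

  distance≤duration : ∀ p w → waitsOK w → distance C p w ≤ duration C p w
  distance≤duration p []           _         = ≤-refl
  distance≤duration p (move d ∷ w) ok        = +-monoʳ-≤ (stepLen C d p) (distance≤duration _ w ok)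
  distance≤duration p (wait t ∷ w) (t≥0 , ok) =
    ≤-trans (distance≤duration p w ok) (p≤q+p (nonNegative⁻¹ t {{t≥0}}))

  energyCost≤timeCost : ∀ {w₁ w₂} → Exploration C w₁ w₂ →
                        energyCost C w₁ w₂ ≤ timeCost C w₁ w₂
  energyCost≤timeCost {w₁} {w₂} (ok₁ , ok₂ , _) =
    ⊔-mono-≤ (distance≤duration 0 w₁ ok₁) (distance≤duration 0 w₂ ok₂)

  -- The clockwise agent (at p⁺, having travelled d⁺) has visited 0, …, i; the
  -- counter-clockwise one (at p⁻, having travelled d⁻) has visited k + 1, …, n - 1 and
  -- stands at k + 1 mod n.
  record Invariant (i k p⁺ : ℕ) (d⁺ : ℚ) (p⁻ : ℕ) (d⁻ : ℚ) (vis : List ℕ) : Set where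
    field
      i≤k       : i ℕ.≤ k
      k<n       : k ℕ.< n
      p⁺≡i      : p⁺ ≡ i
      p⁻≡k+1    : p⁻ ≡ step C cw k
      d⁺≡cwArc  : d⁺ ≡ cwArc i
      d⁻≡ccwArc : d⁻ ≡ ccwArc (suc k)
      cw-short  : cwArc i ≤ ccwArc i
      ccw-short : ccwArc (suc k) ≤ cwArc (suc k)
      visited≤i : ∀ {v} → v ℕ.≤ i → v ∈ vis
      visited>k : ∀ {v} → k ℕ.< v → v ℕ.< n → v ∈ vis

  initial-invariant : Invariant 0 (pred n) 0 0ℚ 0 0ℚ (0 ∷ [])
  initial-invariant = record
    { i≤k       = z≤n
    ; k<n       = subst (pred n ℕ.<_) suc-pred-size (ℕₚ.n<1+n (pred n))
    ; p⁺≡i      = refl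
    ; p⁻≡k+1    = sym (step-cw-last suc-pred-size)
    ; d⁺≡cwArc  = refl
    ; d⁻≡ccwArc = sym (trans (cong ccwArc suc-pred-size) ccwArc-size)
    ; cw-short  = sumℚ-nonNeg lens-nonNeg
    ; ccw-short = subst (λ m → ccwArc m ≤ cwArc m) (sym suc-pred-size)
                        (subst (_≤ cwArc n) (sym ccwArc-size) (cwArc-nonNeg n))
    ; visited≤i = λ { z≤n → here refl }
    ; visited>k = λ k<v v<n → ⊥-elim (ℕₚ.<⇒≱ v<n (subst (ℕ._≤ _) suc-pred-size k<v))
    }

  module _ {i k p⁺ d⁺ p⁻ d⁻ vis} (inv : Invariant i k p⁺ d⁺ p⁻ d⁻ vis) where
    open Invariant inv

    cw-candidate : i ℕ.< k → d⁺ + stepLen C cw p⁺ ≡ cwArc (suc i)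
    cw-candidate i<k rewrite p⁺≡i | d⁺≡cwArc = sym (cwArc-suc (ℕₚ.<-trans i<k k<n))

    ccw-candidate : d⁻ + stepLen C ccw p⁻ ≡ ccwArc k
    ccw-candidate rewrite p⁻≡k+1 | d⁻≡ccwArc | step-ccw-cw k<n = sym (ccwArc-suc k<n)

    cw-move : i ℕ.< k → d⁺ + stepLen C cw p⁺ ≤ d⁻ + stepLen C ccw p⁻ →
              Invariant (suc i) k (step C cw p⁺) (d⁺ + stepLen C cw p⁺) p⁻ d⁻
                        (step C cw p⁺ ∷ vis)
    cw-move i<k cw-first = record
      { i≤k       = i<k
      ; k<n       = k<n
      ; p⁺≡i      = p⁺-moved
      ; p⁻≡k+1    = p⁻≡k+1
      ; d⁺≡cwArc  = cw-candidate i<k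
      ; d⁻≡ccwArc = d⁻≡ccwArc
      ; cw-short  = ≤-trans (subst₂ _≤_ (cw-candidate i<k) ccw-candidate cw-first)
                            (sumℚ-drop-antimono lens-nonNeg i<k)
      ; ccw-short = ccw-short
      ; visited≤i = visited≤suc-i
      ; visited>k = λ k<v v<n → there (visited>k k<v v<n)
      }
      where
      p⁺-moved : step C cw p⁺ ≡ suc i
      p⁺-moved rewrite p⁺≡i = step-cw-inner (ℕₚ.<-≤-trans (s≤s i<k) k<n)
      visited≤suc-i : ∀ {v} → v ℕ.≤ suc i → v ∈ step C cw p⁺ ∷ vis
      visited≤suc-i v≤ with ℕₚ.m≤n⇒m<n∨m≡n v≤
      ... | inj₁ v<suc-i = there (visited≤i (ℕₚ.≤-pred v<suc-i))
      ... | inj₂ refl    = here (sym p⁺-moved)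

    ccw-move : i ℕ.< k → d⁻ + stepLen C ccw p⁻ ≤ d⁺ + stepLen C cw p⁺ →
               Invariant i (pred k) p⁺ d⁺ (step C ccw p⁻) (d⁻ + stepLen C ccw p⁻)
                         (step C ccw p⁻ ∷ vis)
    ccw-move i<k@(s≤s {n = k′} i≤k′) ccw-first = record
      { i≤k       = i≤k′
      ; k<n       = ℕₚ.<-trans (ℕₚ.n<1+n k′) k<n
      ; p⁺≡i      = p⁺≡i
      ; p⁻≡k+1    = trans p⁻-moved (sym (step-cw-inner k<n))
      ; d⁺≡cwArc  = d⁺≡cwArc
      ; d⁻≡ccwArc = ccw-candidate
      ; cw-short  = cw-short
      ; ccw-short = ≤-trans (subst₂ _≤_ ccw-candidate (cw-candidate i<k) ccw-first)
                            (sumℚ-take-mono lens-nonNeg i<k)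
      ; visited≤i = there ∘ visited≤i
      ; visited>k = visited>k′
      }
      where
      p⁻-moved : step C ccw p⁻ ≡ k
      p⁻-moved rewrite p⁻≡k+1 = step-ccw-cw k<n
      visited>k′ : ∀ {v} → k′ ℕ.< v → v ℕ.< n → v ∈ step C ccw p⁻ ∷ vis
      visited>k′ k′<v v<n with ℕₚ.m≤n⇒m<n∨m≡n k′<v
      ... | inj₁ k<v = there (visited>k k<v v<n)
      ... | inj₂ refl = here (sym p⁻-moved)

    i≡k⇒allVisited : i ≡ k → allVisited C vis ≡ true
    i≡k⇒allVisited refl =
      allB-complete (upTo n) (λ v∈ → dec-true (_ ∈? vis) (covered (∈-upTo⁻ v∈)))
      where
      covered : ∀ {v} → v ℕ.< n → v ∈ vis
      covered {v} v<n with v ℕ.≤? i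
      ... | yes v≤i = visited≤i v≤i
      ... | no  v≰i = visited>k (ℕₚ.≰⇒> v≰i) v<n

    unfinished⇒i<k : allVisited C vis ≡ false → i ℕ.< k
    unfinished⇒i<k unfinished with ℕₚ.m≤n⇒m<n∨m≡n i≤k
    ... | inj₁ i<k = i<k
    ... | inj₂ i≡k with trans (sym unfinished) (i≡k⇒allVisited i≡k)
    ...   | ()

  AMPInvariant : Bool → AMPState → Set
  AMPInvariant true  s =
    Σ[ i ∈ ℕ ] Σ[ k ∈ ℕ ] Invariant i k (p₁ s) (d₁ s) (p₂ s) (d₂ s) (visited s)
  AMPInvariant false s =
    Σ[ i ∈ ℕ ] Σ[ k ∈ ℕ ] Invariant i k (p₂ s) (d₂ s) (p₁ s) (d₁ s) (visited s)

  ampStep-preserves : ∀ b s → AMPInvariant b s → allVisited C (visited s) ≡ false →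
                      AMPInvariant b (ampStep C b s)
  ampStep-preserves true s (i , k , inv) unfinished =
    if-does-elim (AMPInvariant true) (_ <? _)
      (λ a₁-first → suc i , k , cw-move inv i<k (<⇒≤ a₁-first))
      (λ a₂-first → i , pred k , ccw-move inv i<k (≮⇒≥ a₂-first))
    where
    i<k : i ℕ.< k
    i<k = unfinished⇒i<k inv unfinished
  ampStep-preserves false s (i , k , inv) unfinished =
    if-does-elim (AMPInvariant false) (_ <? _)
      (λ a₁-first → i , pred k , ccw-move inv i<k (<⇒≤ a₁-first))
      (λ a₂-first → suc i , k , cw-move inv i<k (≮⇒≥ a₂-first))
    where
    i<k : i ℕ.< k
    i<k = unfinished⇒i<k inv unfinished

  ampLoop-preserves : ∀ b fuel s → AMPInvariant b s → AMPInvariant b (ampLoop C b fuel s)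
  ampLoop-preserves b zero       s inv = inv
  ampLoop-preserves b (suc fuel) s inv with allVisited C (visited s) in unfinished
  ... | true  = inv
  ... | false = ampLoop-preserves b fuel (ampStep C b s) (ampStep-preserves b s inv unfinished)

  ampRun-invariant : ∀ b → AMPInvariant b (ampRun C b)
  ampRun-invariant true  = ampLoop-preserves true  n _ (0 , pred n , initial-invariant)
  ampRun-invariant false = ampLoop-preserves false n _ (0 , pred n , initial-invariant)

  WithinReturnDist : ℕ → ℚ → Set
  WithinReturnDist p d = p ℕ.< n × d ≤ ρ p

  invariant-withinReturnDist : ∀ {i k p⁺ d⁺ p⁻ d⁻ vis} → Invariant i k p⁺ d⁺ p⁻ d⁻ vis →
                               WithinReturnDist p⁺ d⁺ × WithinReturnDist p⁻ d⁻
  invariant-withinReturnDist {k = k} record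
    { i≤k = i≤k ; k<n = k<n ; p⁺≡i = refl ; p⁻≡k+1 = refl ; d⁺≡cwArc = refl ; d⁻≡ccwArc = refl
    ; cw-short = cw-short ; ccw-short = ccw-short }
    = (ℕₚ.≤-<-trans i≤k k<n , ⊓-glb ≤-refl cw-short)
    , (step<size cw k<n , subst (ccwArc (suc k) ≤_) (sym (returnDist-step-cw k<n)) (⊓-glb ccw-short ≤-refl))

  ampRun-withinReturnDist : ∀ b → let s = ampRun C b in
                            WithinReturnDist (p₁ s) (d₁ s) × WithinReturnDist (p₂ s) (d₂ s)
  ampRun-withinReturnDist true  = invariant-withinReturnDist (proj₂ (proj₂ (ampRun-invariant true)))
  ampRun-withinReturnDist false = swap (invariant-withinReturnDist (proj₂ (proj₂ (ampRun-invariant false))))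

  withinReturnDist-cost : ∀ {w₁ w₂ p d} → Exploration C w₁ w₂ → WithinReturnDist p d →
                          d + ρ p ≤ energyCost C w₁ w₂
  withinReturnDist-cost {p = p} explores (p<n , d≤ρp) =
    ≤-trans (+-monoˡ-≤ (ρ p) d≤ρp) (energyCost-lowerBound explores p<n)

  ampEnergy≤energyCost : ∀ b {w₁ w₂} → Exploration C w₁ w₂ →
                         ampEnergy C b ≤ energyCost C w₁ w₂
  ampEnergy≤energyCost b explores =
    ⊔-lub (withinReturnDist-cost explores (proj₁ (ampRun-withinReturnDist b)))
          (withinReturnDist-cost explores (proj₂ (ampRun-withinReturnDist b)))

  sequential-time≤3/2*timeCost : ∀ {w₁ w₂ p₁ p₂ d₁ d₂} → Exploration C w₁ w₂ →
                                 WithinReturnDist p₁ d₁ → WithinReturnDist p₂ d₂ →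
                                 d₁ + d₂ + (ρ p₁ ⊔ ρ p₂) ≤ three/two * timeCost C w₁ w₂
  sequential-time≤3/2*timeCost {w₁} {w₂} {p₁} {p₂} {d₁} {d₂}
                               explores (p₁<n , d₁≤ρ₁) (p₂<n , d₂≤ρ₂) =
    begin
      d₁ + d₂ + R          ≤⟨ +-monoˡ-≤ R (+-mono-≤ (≤-trans d₁≤ρ₁ (p≤p⊔q ρ₁ ρ₂))
                                                    (≤-trans d₂≤ρ₂ (p≤q⊔p ρ₁ ρ₂))) ⟩
      R + R + R            ≡⟨ sym (three/two-*-double R) ⟩
      three/two * (R + R)  ≤⟨ *-monoˡ-≤-nonNeg three/two
                                (≤-trans 2R≤energy (energyCost≤timeCost explores)) ⟩
      three/two * timeCost C w₁ w₂ ∎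
    where
    open ≤-Reasoning
    ρ₁ ρ₂ R : ℚ
    ρ₁ = ρ p₁
    ρ₂ = ρ p₂
    R  = ρ₁ ⊔ ρ₂
    2R≤energy : R + R ≤ energyCost C w₁ w₂
    2R≤energy = subst (_≤ energyCost C w₁ w₂) (sym ([p⊔q]+[p⊔q]≡[p+p]⊔[q+q] ρ₁ ρ₂))
      (⊔-lub (energyCost-lowerBound explores p₁<n) (energyCost-lowerBound explores p₂<n))
    three/two-*-double : ∀ x → three/two * (x + x) ≡ x + x + x
    three/two-*-double = solve 1 (λ x → con three/two :* (x :+ x) := x :+ x :+ x) refl
      where open +-*-Solver

  ampTime≤3/2*timeCost : ∀ b {w₁ w₂} → Exploration C w₁ w₂ →
                         ampTime C b ≤ three/two * timeCost C w₁ w₂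
  ampTime≤3/2*timeCost b explores =
    sequential-time≤3/2*timeCost explores (proj₁ (ampRun-withinReturnDist b))
                                          (proj₂ (ampRun-withinReturnDist b))

unitTriangle : Cycle
unitTriangle = record
  { lens   = 1ℚ ∷ 1ℚ ∷ 1ℚ ∷ []
  ; three≤ = s≤s (s≤s (s≤s z≤n))
  ; pos    = _ ∷ _ ∷ _ ∷ []
  }

outAndBack₁ outAndBack₂ : Schedule
outAndBack₁ = move cw ∷ move ccw ∷ []
outAndBack₂ = move ccw ∷ move cw ∷ []

unitTriangle-exploration : Exploration unitTriangle outAndBack₁ outAndBack₂
unitTriangle-exploration = _ , _ , refl , refl , covers
  where
  covers : ∀ v → v ℕ.< 3 → Visits unitTriangle 0 outAndBack₁ v ⊎ Visits unitTriangle 0 outAndBack₂ v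
  covers 0 _ = inj₁ (inj₁ refl)
  covers 1 _ = inj₁ (inj₂ (inj₁ refl))
  covers 2 _ = inj₂ (inj₂ (inj₁ refl))
  covers (suc (suc (suc _))) (s≤s (s≤s (s≤s ())))

unitTriangle-ampEnergy : ∀ b →
  ampEnergy unitTriangle b ≡ 1ℚ * energyCost unitTriangle outAndBack₁ outAndBack₂
unitTriangle-ampEnergy true  = refl
unitTriangle-ampEnergy false = refl

unitTriangle-ampTime : ∀ b →
  ampTime unitTriangle b ≡ three/two * timeCost unitTriangle outAndBack₁ outAndBack₂
unitTriangle-ampTime true  = refl
unitTriangle-ampTime false = refl

ratio-attained : ∀ {c x y} ε → Positive ε → .{{Positive x}} → y ≡ c * x → (c - ε) * x < y
ratio-attained {c} {x} _ ε>0 refl = *-monoˡ-<-pos x (p-q<p c ε>0)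

theorem4 :
    -- energy model: competitive ratio 1
    ((b : Bool) (C : Cycle) (w₁ w₂ : Schedule) → Exploration C w₁ w₂ →
       ampEnergy C b ≤ 1ℚ * energyCost C w₁ w₂)
    ×
    ((b : Bool) (ε : ℚ) → Positive ε →
       Σ[ C ∈ Cycle ] Σ[ w₁ ∈ Schedule ] Σ[ w₂ ∈ Schedule ]
         (Exploration C w₁ w₂ × (1ℚ - ε) * energyCost C w₁ w₂ < ampEnergy C b))
    ×
    -- time model: competitive ratio 3/2
    ((b : Bool) (C : Cycle) (w₁ w₂ : Schedule) → Exploration C w₁ w₂ →
       ampTime C b ≤ three/two * timeCost C w₁ w₂)
    ×
    ((b : Bool) (ε : ℚ) → Positive ε →
       Σ[ C ∈ Cycle ] Σ[ w₁ ∈ Schedule ] Σ[ w₂ ∈ Schedule ]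
         (Exploration C w₁ w₂ × (three/two - ε) * timeCost C w₁ w₂ < ampTime C b))
theorem4 =
    (λ b C w₁ w₂ explores →
       subst (ampEnergy C b ≤_) (sym (*-identityˡ _)) (ampEnergy≤energyCost C b explores))
  , (λ b ε ε>0 → unitTriangle , outAndBack₁ , outAndBack₂ , unitTriangle-exploration
                 , ratio-attained ε ε>0 (unitTriangle-ampEnergy b))
  , (λ b C w₁ w₂ explores → ampTime≤3/2*timeCost C b explores)
  , (λ b ε ε>0 → unitTriangle , outAndBack₁ , outAndBack₂ , unitTriangle-exploration
                 , ratio-attained ε ε>0 (unitTriangle-ampTime b))
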